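{- Let $\overrightarrow{G}=\overrightarrow{G}(U\cup W,E)$ be a thin 2-qBMG with color classes $U$ and $W$. Let $U_1\subseteq U$ and $W_1\subseteq W$ be $\mathrm{Aut}(\overrightarrow{G})$-orbits, and let $\overrightarrow{G}_1=\overrightarrow{G}_1(V_1,E_1)$ be the subdigraph of $\overrightarrow{G}$ induced on $V_1=U_1\cup W_1$. If there exist $x_1\in U_1$ and $y_1\in W_1$ with $x_1y_1\in E$, then one of the following holds: (i) $\overrightarrow{G}_1$ is the union of pairwise vertex-disjoint stars in which every vertex of $U_1$ is a source and every vertex of $W_1$ is a sink, and $|N_1^+(x_1)|\cdot|U_1|=|W_1|$, where $N_1^+(x_1)$ is the out-neighborhood of $x_1$ in $\overrightarrow{G}_1$; in particular, if $|U_1|=|W_1|$ then $E_1$ is the union of pairwise vertex-disjoint edges; (ii) $E_1$ is the union of pairwise vertex-disjoint symmetric edges.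
   Context: A digraph $\overrightarrow{G}=\overrightarrow{G}(V,E)$ has a finite vertex set $V$ and edge set $E\subseteq V\times V$ without loops ($uv$ denotes the edge with tail $u$ and head $v$); a symmetric edge is a pair $uv,vu\in E$. $N^+(v)=\{w:vw\in E\}$, $N^-(v)=\{w:wv\in E\}$; a source has no in-neighbors and a sink no out-neighbors. Two vertices $u,v$ are independent if neither $uv$ nor $vu$ is in $E$. A 2-qBMG is a digraph, equipped with a partition $V=U\cup W$ into two color classes such that every edge joins a vertex of $U$ and a vertex of $W$, satisfying: (N1) if $u,v$ are independent then there are no vertices $w,t$ with $ut,vw,tw\in E$; (N2) if $uv,vw,wt\in E$ then $ut\in E$; (N3) if $u,v$ have a common out-neighbor then $N^+(u)\subseteq N^+(v)$ or $N^+(v)\subseteq N^+(u)$. The digraph is thin if no two distinct vertices $x,y$ satisfy both $N^+(x)=N^+(y)$ and $N^-(x)=N^-(y)$. An automorphism is a permutation $\pi$ of $V$ with $xy\in E\Rightarrow\pi(x)\pi(y)\in E$; $\mathrm{Aut}(\overrightarrow{G})$ is the group of all automorphisms. -}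

module Defs where

open import Data.Nat using (ℕ)
open import Data.Bool using (Bool; true; false; _∧_; _∨_)
open import Data.Fin using (Fin)
open import Data.Fin.Subset using (Subset; _∈_; ∣_∣)
open import Data.Fin.Permutation using (Permutation′; _⟨$⟩ʳ_)
open import Data.Vec using (tabulate; lookup)
open import Data.Product using (_×_; ∃; ∃-syntax; _,_)
open import Data.Sum using (_⊎_)
open import Relation.Nullary using (¬_)
open import Relation.Binary.PropositionalEquality using (_≡_; _≢_)

Edges : ℕ → Set
Edges n = Fin n → Fin n → Bool

module _ {n : ℕ} (E : Edges n) where

  Adj : Fin n → Fin n → Set
  Adj u v = E u v ≡ true

  Loopless : Set
  Loopless = ∀ v → E v v ≡ false

  -- coloring: col v ≡ true means v ∈ U, col v ≡ false means v ∈ W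
  ProperColoring : (Fin n → Bool) → Set
  ProperColoring col = ∀ u v → Adj u v → col u ≢ col v

  Independent : Fin n → Fin n → Set
  Independent u v = ¬ Adj u v × ¬ Adj v u

  OutSub : Fin n → Fin n → Set
  OutSub u v = ∀ w → Adj u w → Adj v w

  N1 : Set
  N1 = ∀ u v → Independent u v → ¬ (∃[ w ] ∃[ t ] (Adj u t × Adj v w × Adj t w))

  N2 : Set
  N2 = ∀ u v w t → Adj u v → Adj v w → Adj w t → Adj u t

  N3 : Set
  N3 = ∀ u v → (∃[ w ] (Adj u w × Adj v w)) → OutSub u v ⊎ OutSub v u

  Is2qBMG : (Fin n → Bool) → Set
  Is2qBMG col = Loopless × ProperColoring col × N1 × N2 × N3

  Thin : Set
  Thin = ∀ x y → (∀ z → (Adj x z → Adj y z) × (Adj y z → Adj x z))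
                → (∀ z → (Adj z x → Adj z y) × (Adj z y → Adj z x))
                → x ≡ y

  IsAut : Permutation′ n → Set
  IsAut π = ∀ x y → Adj x y → Adj (π ⟨$⟩ʳ x) (π ⟨$⟩ʳ y)

  IsOrbit : Subset n → Set
  IsOrbit S = ∃[ x₀ ] (∀ y → (y ∈ S → ∃[ π ] (IsAut π × π ⟨$⟩ʳ x₀ ≡ y))
                            × (∃[ π ] (IsAut π × π ⟨$⟩ʳ x₀ ≡ y) → y ∈ S))

  module _ (U₁ W₁ : Subset n) where

    InV₁ : Fin n → Set
    InV₁ v = v ∈ U₁ ⊎ v ∈ W₁

    E₁ : Fin n → Fin n → Set
    E₁ u v = InV₁ u × InV₁ v × Adj u v

    N₁⁺ : Fin n → Subset n
    N₁⁺ x = tabulate (λ y → E x y ∧ (lookup U₁ y ∨ lookup W₁ y))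

    UAdj₁ : Fin n → Fin n → Set
    UAdj₁ x y = E₁ x y ⊎ E₁ y x

    LeafOf : Fin n → Fin n → Set
    LeafOf x y = ∀ z → UAdj₁ x z → z ≡ y

    -- G₁ is a union of pairwise vertex-disjoint stars: every edge of G₁
    -- has an endpoint of degree one (in the underlying graph).
    StarForest₁ : Set
    StarForest₁ = ∀ x y → E₁ x y → LeafOf x y ⊎ LeafOf y x

    SourcesU₁ : Set
    SourcesU₁ = ∀ u → u ∈ U₁ → ∀ z → ¬ E₁ z u

    SinksW₁ : Set
    SinksW₁ = ∀ w → w ∈ W₁ → ∀ z → ¬ E₁ w z

    Disj : Fin n → Fin n → Fin n → Fin n → Set
    Disj a b c d = a ≢ c × a ≢ d × b ≢ c × b ≢ d

    DisjointEdges₁ : Set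
    DisjointEdges₁ = ∀ a b c d → E₁ a b → E₁ c d → (a ≡ c × b ≡ d) ⊎ Disj a b c d

    DisjointSymEdges₁ : Set
    DisjointSymEdges₁ =
      (∀ a b → E₁ a b → E₁ b a) ×
      (∀ a b c d → E₁ a b → E₁ c d →
          ((a ≡ c × b ≡ d) ⊎ (a ≡ d × b ≡ c)) ⊎ Disj a b c d)

{-# OPTIONS --safe #-}
-- Two vertices of one Aut-orbit with a common out-neighbour coincide: by (N3) one
-- out-neighbourhood contains the other, and an automorphism carrying one vertex to the other
-- makes the inclusion an equality (automorphisms of a finite digraph preserve edge counts, so
-- they also reflect edges); (N1) and (N2) give the same for in-neighbourhoods, and thinness
-- concludes.  Hence every vertex of G₁ has at most one in-neighbour.
-- If some edge runs from W₁ to U₁, every vertex of V₁ has an out-neighbour in the other orbit;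
-- extending an edge s → t to a path s → t → u → w, (N2) gives s → w, so u = s and t → s: all
-- edges of G₁ are symmetric.  Otherwise all edges run from U₁ to W₁, each vertex of W₁ has
-- exactly one in-neighbour, and double counting the edges gives |N₁⁺(x₁)|·|U₁| = |W₁|.
module Submission where

open import Defs
open import Data.Nat using (ℕ; zero; suc; _+_; _*_; _≤_; z≤n; s≤s; >-nonZero)
open import Data.Nat.Properties
  using (≤-refl; ≤-reflexive; ≤-trans; ≤-antisym; m≤n+m; +-mono-≤; +-monoʳ-≤; +-cancelʳ-≤;
         +-cancelˡ-≡; +-identityʳ; *-comm; *-identityˡ; *-cancelʳ-≡;
         +-0-commutativeMonoid; +-*-semiring; module ≤-Reasoning)
open import Data.Bool using (Bool; true; false; _∧_; _∨_)
import Data.Bool.Properties as Bool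
open import Data.Fin using (Fin; zero; suc; _≟_)
open import Data.Fin.Properties using (suc-injective; any?)
open import Data.Fin.Subset using (Subset; _∈_; ∣_∣)
open import Data.Fin.Subset.Properties using (_∈?_)
open import Data.Fin.Permutation using (Permutation′; _⟨$⟩ʳ_; _∘ₚ_; inverseˡ; inverseʳ)
  renaming (flip to _⁻¹)
open import Data.Vec using (tabulate; lookup)
open import Data.Vec.Properties using (tabulate∘lookup; []=⇒lookup; lookup⇒[]=)
open import Data.Product using (_×_; ∃-syntax; _,_; proj₁; proj₂)
open import Data.Sum using (_⊎_; inj₁; inj₂)
open import Data.Empty using (⊥; ⊥-elim)
open import Function using (_∘_; flip; case_of_)
open import Relation.Nullary using (¬_; Dec; yes; no)
open import Relation.Nullary.Decidable using (_×-dec_)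
open import Relation.Binary.PropositionalEquality
open import Algebra.Properties.CommutativeMonoid.Sum +-0-commutativeMonoid
  using (sum; sum-cong-≗; ∑-comm; ∑-permute)
open import Algebra.Properties.Semiring.Sum +-*-semiring using (*-distribʳ-sum)

𝕀 : Bool → ℕ
𝕀 true  = 1
𝕀 false = 0

𝕀-mono : ∀ {a b} → (a ≡ true → b ≡ true) → 𝕀 a ≤ 𝕀 b
𝕀-mono {false} _   = z≤n
𝕀-mono {true}  a⇒b rewrite a⇒b refl = ≤-refl

𝕀-injective : ∀ {a b} → 𝕀 a ≡ 𝕀 b → a ≡ b
𝕀-injective {false} {false} _ = refl
𝕀-injective {true}  {true}  _ = refl

count : ∀ {n} → (Fin n → Bool) → ℕ
count P = sum (𝕀 ∘ P)

∣tabulate∣≡count : ∀ {n} (P : Fin n → Bool) → ∣ tabulate P ∣ ≡ count P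
∣tabulate∣≡count {zero}  P = refl
∣tabulate∣≡count {suc n} P with P zero
... | true  = cong suc (∣tabulate∣≡count (P ∘ suc))
... | false = ∣tabulate∣≡count (P ∘ suc)

∣p∣≡count : ∀ {n} (p : Subset n) → ∣ p ∣ ≡ count (lookup p)
∣p∣≡count p = trans (cong ∣_∣ (sym (tabulate∘lookup p))) (∣tabulate∣≡count (lookup p))

sum-mono-≤ : ∀ {n} (f g : Fin n → ℕ) → (∀ i → f i ≤ g i) → sum f ≤ sum g
sum-mono-≤ {zero}  f g f≤g = z≤n
sum-mono-≤ {suc n} f g f≤g = +-mono-≤ (f≤g zero) (sum-mono-≤ (f ∘ suc) (g ∘ suc) (f≤g ∘ suc))

+-mono-≤-≡⇒≡ˡ : ∀ {m n o p} → m ≤ n → o ≤ p → m + o ≡ n + p → m ≡ n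
+-mono-≤-≡⇒≡ˡ {m} {n} {o} {p} m≤n o≤p eq = ≤-antisym m≤n (+-cancelʳ-≤ o n m (begin
  n + o  ≤⟨ +-monoʳ-≤ n o≤p ⟩
  n + p  ≡⟨ sym eq ⟩
  m + o  ∎))
  where open ≤-Reasoning

sum-mono-≤-≡⇒≗ : ∀ {n} (f g : Fin n → ℕ) → (∀ i → f i ≤ g i) → sum f ≡ sum g → ∀ i → f i ≡ g i
sum-mono-≤-≡⇒≗ f g f≤g eq zero = +-mono-≤-≡⇒≡ˡ (f≤g zero) (sum-mono-≤ (f ∘ suc) (g ∘ suc) (f≤g ∘ suc)) eq
sum-mono-≤-≡⇒≗ f g f≤g eq (suc i) = sum-mono-≤-≡⇒≗ (f ∘ suc) (g ∘ suc) (f≤g ∘ suc) tail-eq i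
  where
  tail-eq : sum (f ∘ suc) ≡ sum (g ∘ suc)
  tail-eq = +-cancelˡ-≡ (f zero) _ _
    (trans eq (cong (_+ sum (g ∘ suc)) (sym (sum-mono-≤-≡⇒≗ f g f≤g eq zero))))

count-mono : ∀ {n} (P Q : Fin n → Bool) → (∀ i → P i ≡ true → Q i ≡ true) → count P ≤ count Q
count-mono P Q P⊆Q = sum-mono-≤ (𝕀 ∘ P) (𝕀 ∘ Q) (λ i → 𝕀-mono (P⊆Q i))

count-⊆-≡⇒⊇ : ∀ {n} (P Q : Fin n → Bool) → (∀ i → P i ≡ true → Q i ≡ true) → count P ≡ count Q
            → ∀ i → Q i ≡ true → P i ≡ true
count-⊆-≡⇒⊇ P Q P⊆Q eq i Qi =
  trans (𝕀-injective (sum-mono-≤-≡⇒≗ (𝕀 ∘ P) (𝕀 ∘ Q) (λ j → 𝕀-mono (P⊆Q j)) eq i)) Qi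

count-permute : ∀ {n} (P : Fin n → Bool) (σ : Permutation′ n) → count P ≡ count (P ∘ (σ ⟨$⟩ʳ_))
count-permute P σ = ∑-permute (𝕀 ∘ P) σ

count-≡0 : ∀ {n} (P : Fin n → Bool) → (∀ i → ¬ P i ≡ true) → count P ≡ 0
count-≡0 {zero}  P ¬P = refl
count-≡0 {suc n} P ¬P with P zero in P0
... | true  = ⊥-elim (¬P zero P0)
... | false = count-≡0 (P ∘ suc) (¬P ∘ suc)

count-≡1 : ∀ {n} (P : Fin n → Bool) {i} → P i ≡ true → (∀ j → P j ≡ true → j ≡ i) → count P ≡ 1
count-≡1 P {zero} P0 unique rewrite P0 =
  cong suc (count-≡0 (P ∘ suc) (λ j Psj → case unique (suc j) Psj of λ ()))
count-≡1 P {suc i} Psi unique with P zero in P0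
... | true  = case unique zero P0 of λ ()
... | false = count-≡1 (P ∘ suc) Psi (λ j Psj → suc-injective (unique (suc j) Psj))

count-≥1 : ∀ {n} (P : Fin n → Bool) {i} → P i ≡ true → 1 ≤ count P
count-≥1 P {zero}  P0 rewrite P0 = s≤s z≤n
count-≥1 P {suc i} Pi = ≤-trans (count-≥1 (P ∘ suc) Pi) (m≤n+m _ (𝕀 (P zero)))

count-≥2 : ∀ {n} (P : Fin n → Bool) {i j} → P i ≡ true → P j ≡ true → i ≢ j → 2 ≤ count P
count-≥2 P {zero}  {zero}  _  _  i≢j = ⊥-elim (i≢j refl)
count-≥2 P {zero}  {suc j} P0 Pj _   rewrite P0 = s≤s (count-≥1 (P ∘ suc) Pj)
count-≥2 P {suc i} {zero}  Pi P0 _   rewrite P0 = s≤s (count-≥1 (P ∘ suc) Pi)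
count-≥2 P {suc i} {suc j} Pi Pj i≢j =
  ≤-trans (count-≥2 (P ∘ suc) Pi Pj (i≢j ∘ cong suc)) (m≤n+m _ (𝕀 (P zero)))

double-count : ∀ {m n} (R : Fin m → Fin n → Bool) (A : Fin m → Bool) (B : Fin n → Bool) (d : ℕ)
  → (∀ i j → R i j ≡ true → A i ≡ true) → (∀ i → A i ≡ true → count (R i) ≡ d)
  → (∀ i j → R i j ≡ true → B j ≡ true) → (∀ j → B j ≡ true → count (λ i → R i j) ≡ 1)
  → count A * d ≡ count B
double-count R A B d R⊆A rows R⊆B columns = begin
  count A * d                          ≡⟨ *-distribʳ-sum d (𝕀 ∘ A) ⟩
  sum (λ i → 𝕀 (A i) * d)              ≡⟨ sum-cong-≗ row ⟩
  sum (λ i → sum (λ j → 𝕀 (R i j)))    ≡⟨ ∑-comm (λ i j → 𝕀 (R i j)) ⟩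
  sum (λ j → sum (λ i → 𝕀 (R i j)))    ≡⟨ sum-cong-≗ column ⟩
  count B                              ∎
  where
  open ≡-Reasoning
  row : ∀ i → 𝕀 (A i) * d ≡ count (R i)
  row i with A i in Ai
  ... | true  = trans (+-identityʳ d) (sym (rows i Ai))
  ... | false = sym (count-≡0 (R i) (λ j Rij → case trans (sym Ai) (R⊆A i j Rij) of λ ()))
  column : ∀ j → count (λ i → R i j) ≡ 𝕀 (B j)
  column j with B j in Bj
  ... | true  = columns j Bj
  ... | false = count-≡0 (λ i → R i j) (λ i Rij → case trans (sym Bj) (R⊆B i j Rij) of λ ())

bool-≡ : ∀ {a b} → (a ≡ true → b ≡ true) → (b ≡ true → a ≡ true) → a ≡ b
bool-≡ {false} {false} _   _   = refl
bool-≡ {false} {true}  _   b⇒a = b⇒a refl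
bool-≡ {true}          a⇒b _   = sym (a⇒b refl)

permutation-reflects₂ : ∀ {n} (R : Fin n → Fin n → Bool) (σ : Permutation′ n)
  → (∀ i j → R i j ≡ true → R (σ ⟨$⟩ʳ i) (σ ⟨$⟩ʳ j) ≡ true)
  → ∀ i j → R (σ ⟨$⟩ʳ i) (σ ⟨$⟩ʳ j) ≡ true → R i j ≡ true
permutation-reflects₂ R σ R⊆Rσ i =
  count-⊆-≡⇒⊇ (R i) (Rσ (σ ⟨$⟩ʳ i)) (R⊆Rσ i) (trans (rows-permuted i) (count-permute _ σ))
  where
  Rσ : Fin _ → Fin _ → Bool
  Rσ i' j = R i' (σ ⟨$⟩ʳ j)
  rows : Fin _ → ℕ
  rows i' = count (R i')
  rows-permuted : ∀ i' → rows i' ≡ rows (σ ⟨$⟩ʳ i')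
  rows-permuted = sum-mono-≤-≡⇒≗ rows (rows ∘ (σ ⟨$⟩ʳ_))
    (λ i' → ≤-trans (count-mono (R i') _ (R⊆Rσ i')) (≤-reflexive (sym (count-permute _ σ))))
    (∑-permute rows σ)

module Automorphisms {n : ℕ} (E : Edges n) where

  IsAut-∘ : ∀ π ρ → IsAut E π → IsAut E ρ → IsAut E (π ∘ₚ ρ)
  IsAut-∘ π ρ π-aut ρ-aut x y xy = ρ-aut _ _ (π-aut x y xy)

  IsAut-reflects : ∀ π → IsAut E π → ∀ x y → Adj E (π ⟨$⟩ʳ x) (π ⟨$⟩ʳ y) → Adj E x y
  IsAut-reflects π = permutation-reflects₂ E π

  IsAut-preserves-E : ∀ π → IsAut E π → ∀ x y → E (π ⟨$⟩ʳ x) (π ⟨$⟩ʳ y) ≡ E x y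
  IsAut-preserves-E π π-aut x y = bool-≡ (IsAut-reflects π π-aut x y) (π-aut x y)

  IsAut-⁻¹ : ∀ π → IsAut E π → IsAut E (π ⁻¹)
  IsAut-⁻¹ π π-aut x y xy = IsAut-reflects π π-aut _ _
    (subst₂ (Adj E) (sym (inverseʳ π)) (sym (inverseʳ π)) xy)

  deg⁺-aut : ∀ π → IsAut E π → (Q : Fin n → Bool) → (∀ w → Q (π ⟨$⟩ʳ w) ≡ Q w)
    → ∀ u → count (λ w → Q w ∧ E (π ⟨$⟩ʳ u) w) ≡ count (λ w → Q w ∧ E u w)
  deg⁺-aut π π-aut Q Q-inv u = trans (count-permute _ π)
    (sum-cong-≗ (λ w → cong 𝕀 (cong₂ _∧_ (Q-inv w) (IsAut-preserves-E π π-aut u w))))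

  OutSub-aut-sym : ∀ σ → IsAut E σ → ∀ u → OutSub E (σ ⟨$⟩ʳ u) u → OutSub E u (σ ⟨$⟩ʳ u)
  OutSub-aut-sym σ σ-aut u σu⊆u =
    count-⊆-≡⇒⊇ (E (σ ⟨$⟩ʳ u)) (E u) σu⊆u (deg⁺-aut σ σ-aut (λ _ → true) (λ _ → refl) u)

module _ {n : ℕ} {E : Edges n} {S : Subset n} (S-orbit : IsOrbit E S) where

  open Automorphisms E

  private
    reach : ∀ {y} → y ∈ S → ∃[ π ] (IsAut E π × π ⟨$⟩ʳ proj₁ S-orbit ≡ y)
    reach = proj₁ (proj₂ S-orbit _)

  orbit-closed : ∀ π → IsAut E π → ∀ {y} → y ∈ S → π ⟨$⟩ʳ y ∈ S
  orbit-closed π π-aut y∈S with reach y∈S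
  ... | σ , σ-aut , refl = proj₂ (proj₂ S-orbit _) (σ ∘ₚ π , IsAut-∘ σ π σ-aut π-aut , refl)

  orbit-closed⁻¹ : ∀ π → IsAut E π → ∀ {y} → π ⟨$⟩ʳ y ∈ S → y ∈ S
  orbit-closed⁻¹ π π-aut πy∈S = subst (_∈ S) (inverseˡ π) (orbit-closed (π ⁻¹) (IsAut-⁻¹ π π-aut) πy∈S)

  orbit-lookup-aut : ∀ π → IsAut E π → ∀ y → lookup S (π ⟨$⟩ʳ y) ≡ lookup S y
  orbit-lookup-aut π π-aut y = bool-≡
    (λ πy∈S → []=⇒lookup (orbit-closed⁻¹ π π-aut (lookup⇒[]= _ S πy∈S)))
    (λ y∈S → []=⇒lookup (orbit-closed π π-aut (lookup⇒[]= y S y∈S)))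

  orbit-transitive : ∀ {y y'} → y ∈ S → y' ∈ S → ∃[ π ] (IsAut E π × π ⟨$⟩ʳ y ≡ y')
  orbit-transitive y∈S y'∈S with reach y∈S | reach y'∈S
  ... | σ , σ-aut , refl | τ , τ-aut , refl =
    σ ⁻¹ ∘ₚ τ , IsAut-∘ (σ ⁻¹) τ (IsAut-⁻¹ σ σ-aut) τ-aut , cong (τ ⟨$⟩ʳ_) (inverseˡ σ)

  orbit-OutSub-sym : ∀ {u u'} → u ∈ S → u' ∈ S → OutSub E u' u → OutSub E u u'
  orbit-OutSub-sym u∈S u'∈S with orbit-transitive u∈S u'∈S
  ... | π , π-aut , refl = OutSub-aut-sym π π-aut _

  orbit-InSub-sym : ∀ {u u'} → u ∈ S → u' ∈ S → OutSub (flip E) u' u → OutSub (flip E) u u'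
  orbit-InSub-sym u∈S u'∈S with orbit-transitive u∈S u'∈S
  ... | π , π-aut , refl = Automorphisms.OutSub-aut-sym (flip E) π (λ x y → π-aut y x) _

  orbit-common-out⇒OutSub : N3 E → ∀ {u u' w} → u ∈ S → u' ∈ S → Adj E u w → Adj E u' w → OutSub E u u'
  orbit-common-out⇒OutSub n3 u∈S u'∈S uw u'w with n3 _ _ (_ , uw , u'w)
  ... | inj₁ u⊆u' = u⊆u'
  ... | inj₂ u'⊆u = orbit-OutSub-sym u∈S u'∈S u'⊆u

  -- If z ↛ u', then u' → z by N1, and N2 along y → u' → z → u gives N⁻(u') ⊆ N⁻(u),
  -- which the orbit turns into equality.
  orbit-common-out⇒InSub : N1 E → N2 E → ∀ {u u' w} → u ∈ S → u' ∈ S → Adj E u w → Adj E u' w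
                         → OutSub (flip E) u u'
  orbit-common-out⇒InSub n1 n2 {u} {u'} {w} u∈S u'∈S uw u'w z zu with E z u' Bool.≟ true
  ... | yes zu' = zu'
  ... | no ¬zu' with E u' z Bool.≟ true
  ...   | no ¬u'z = ⊥-elim (n1 z u' (¬zu' , ¬u'z) (w , u , zu , u'w , uw))
  ...   | yes u'z = orbit-InSub-sym u∈S u'∈S (λ y yu' → n2 y u' z u yu' u'z zu) z zu

  orbit-common-out⇒≡ : N1 E → N2 E → N3 E → Thin E
                     → ∀ {u u' w} → u ∈ S → u' ∈ S → Adj E u w → Adj E u' w → u ≡ u'
  orbit-common-out⇒≡ n1 n2 n3 thin u∈S u'∈S uw u'w = thin _ _
    (λ z → orbit-common-out⇒OutSub n3 u∈S u'∈S uw u'w z , orbit-common-out⇒OutSub n3 u'∈S u∈S u'w uw z)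
    (λ z → orbit-common-out⇒InSub n1 n2 u∈S u'∈S uw u'w z , orbit-common-out⇒InSub n1 n2 u'∈S u∈S u'w uw z)

module _ {n : ℕ} {E : Edges n} {S T : Subset n} (S-orbit : IsOrbit E S) (T-orbit : IsOrbit E T) where

  orbit-out-neighbour : ∀ {a b a'} → a ∈ S → b ∈ T → Adj E a b → a' ∈ S → ∃[ b' ] (b' ∈ T × Adj E a' b')
  orbit-out-neighbour a∈S b∈T ab a'∈S with orbit-transitive S-orbit a∈S a'∈S
  ... | π , π-aut , refl = π ⟨$⟩ʳ _ , orbit-closed T-orbit π π-aut b∈T , π-aut _ _ ab

  orbit-in-neighbour : ∀ {a b b'} → a ∈ S → b ∈ T → Adj E a b → b' ∈ T → ∃[ a' ] (a' ∈ S × Adj E a' b')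
  orbit-in-neighbour a∈S b∈T ab b'∈T with orbit-transitive T-orbit b∈T b'∈T
  ... | π , π-aut , refl = π ⟨$⟩ʳ _ , orbit-closed S-orbit π π-aut a∈S , π-aut _ _ ab

mutual-out-neighbours⇒sym : ∀ {n} {E : Edges n} {S T : Subset n} → N2 E
  → (∀ {u u' w} → u ∈ S → u' ∈ S → Adj E u w → Adj E u' w → u ≡ u')
  → (∀ {s} → s ∈ S → ∃[ t ] (t ∈ T × Adj E s t))
  → (∀ {t} → t ∈ T → ∃[ s ] (s ∈ S × Adj E t s))
  → ∀ {s t} → s ∈ S → t ∈ T → Adj E s t → Adj E t s
mutual-out-neighbours⇒sym {E = E} n2 S-common-out⇒≡ S→T T→S s∈S t∈T st with T→S t∈T
... | u , u∈S , tu with S→T u∈S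
... | w , _ , uw = subst (Adj E _) (sym (S-common-out⇒≡ s∈S u∈S (n2 _ _ _ _ st tu uw) uw)) tu

module OrbitPair {n : ℕ} {E : Edges n} {col : Fin n → Bool}
  (proper : ProperColoring E col) (n1 : N1 E) (n2 : N2 E) (n3 : N3 E) (thin : Thin E)
  {U₁ W₁ : Subset n} (U₁⊆U : ∀ x → x ∈ U₁ → col x ≡ true) (W₁⊆W : ∀ x → x ∈ W₁ → col x ≡ false)
  (U₁-orbit : IsOrbit E U₁) (W₁-orbit : IsOrbit E W₁)
  {x₁ y₁ : Fin n} (x₁∈U₁ : x₁ ∈ U₁) (y₁∈W₁ : y₁ ∈ W₁) (x₁y₁ : Adj E x₁ y₁) where

  U₁∩W₁≡∅ : ∀ {x} → x ∈ U₁ → x ∈ W₁ → ⊥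
  U₁∩W₁≡∅ {x} x∈U₁ x∈W₁ = case trans (sym (U₁⊆U x x∈U₁)) (W₁⊆W x x∈W₁) of λ ()

  U₁-independent : ∀ {a b} → a ∈ U₁ → b ∈ U₁ → ¬ Adj E a b
  U₁-independent a∈U₁ b∈U₁ ab = proper _ _ ab (trans (U₁⊆U _ a∈U₁) (sym (U₁⊆U _ b∈U₁)))

  W₁-independent : ∀ {a b} → a ∈ W₁ → b ∈ W₁ → ¬ Adj E a b
  W₁-independent a∈W₁ b∈W₁ ab = proper _ _ ab (trans (W₁⊆W _ a∈W₁) (sym (W₁⊆W _ b∈W₁)))

  E₁-orientation : ∀ {a b} → E₁ E U₁ W₁ a b → (a ∈ U₁ × b ∈ W₁) ⊎ (a ∈ W₁ × b ∈ U₁)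
  E₁-orientation (inj₁ a∈U₁ , inj₁ b∈U₁ , ab) = ⊥-elim (U₁-independent a∈U₁ b∈U₁ ab)
  E₁-orientation (inj₁ a∈U₁ , inj₂ b∈W₁ , _)  = inj₁ (a∈U₁ , b∈W₁)
  E₁-orientation (inj₂ a∈W₁ , inj₁ b∈U₁ , _)  = inj₂ (a∈W₁ , b∈U₁)
  E₁-orientation (inj₂ a∈W₁ , inj₂ b∈W₁ , ab) = ⊥-elim (W₁-independent a∈W₁ b∈W₁ ab)

  U₁-common-out⇒≡ : ∀ {u u' w} → u ∈ U₁ → u' ∈ U₁ → Adj E u w → Adj E u' w → u ≡ u'
  U₁-common-out⇒≡ = orbit-common-out⇒≡ U₁-orbit n1 n2 n3 thin

  W₁-common-out⇒≡ : ∀ {w w' u} → w ∈ W₁ → w' ∈ W₁ → Adj E w u → Adj E w' u → w ≡ w'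
  W₁-common-out⇒≡ = orbit-common-out⇒≡ W₁-orbit n1 n2 n3 thin

  E₁-common-head⇒≡ : ∀ {a c b} → E₁ E U₁ W₁ a b → E₁ E U₁ W₁ c b → a ≡ c
  E₁-common-head⇒≡ ab@(_ , _ , ab′) cb@(_ , _ , cb′) with E₁-orientation ab | E₁-orientation cb
  ... | inj₁ (a∈U₁ , _)    | inj₁ (c∈U₁ , _)    = U₁-common-out⇒≡ a∈U₁ c∈U₁ ab′ cb′
  ... | inj₂ (a∈W₁ , _)    | inj₂ (c∈W₁ , _)    = W₁-common-out⇒≡ a∈W₁ c∈W₁ ab′ cb′
  ... | inj₁ (_ , b∈W₁)    | inj₂ (_ , b∈U₁)    = ⊥-elim (U₁∩W₁≡∅ b∈U₁ b∈W₁)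
  ... | inj₂ (_ , b∈U₁)    | inj₁ (_ , b∈W₁)    = ⊥-elim (U₁∩W₁≡∅ b∈U₁ b∈W₁)

  U₁-out-neighbour : ∀ {u} → u ∈ U₁ → ∃[ w ] (w ∈ W₁ × Adj E u w)
  U₁-out-neighbour = orbit-out-neighbour U₁-orbit W₁-orbit x₁∈U₁ y₁∈W₁ x₁y₁

  W₁-in-neighbour : ∀ {w} → w ∈ W₁ → ∃[ u ] (u ∈ U₁ × Adj E u w)
  W₁-in-neighbour = orbit-in-neighbour U₁-orbit W₁-orbit x₁∈U₁ y₁∈W₁ x₁y₁

  deg⁺W₁ : Fin n → ℕ
  deg⁺W₁ u = count (λ w → lookup W₁ w ∧ E u w)

  deg⁺W₁-orbit : ∀ {u} → u ∈ U₁ → deg⁺W₁ u ≡ deg⁺W₁ x₁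
  deg⁺W₁-orbit u∈U₁ with orbit-transitive U₁-orbit x₁∈U₁ u∈U₁
  ... | π , π-aut , refl =
    Automorphisms.deg⁺-aut E π π-aut (lookup W₁) (orbit-lookup-aut W₁-orbit π π-aut) x₁

  ∣N₁⁺∣≡deg⁺W₁ : ∀ {u} → u ∈ U₁ → ∣ N₁⁺ E U₁ W₁ u ∣ ≡ deg⁺W₁ u
  ∣N₁⁺∣≡deg⁺W₁ {u} u∈U₁ =
    trans (∣tabulate∣≡count (λ w → E u w ∧ (lookup U₁ w ∨ lookup W₁ w)))
          (sum-cong-≗ (cong 𝕀 ∘ out-of-U₁))
    where
    out-of-U₁ : ∀ w → E u w ∧ (lookup U₁ w ∨ lookup W₁ w) ≡ lookup W₁ w ∧ E u w
    out-of-U₁ w with E u w in uw | lookup U₁ w in w∈U₁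
    ... | false | _     = sym (Bool.∧-zeroʳ _)
    ... | true  | false = sym (Bool.∧-identityʳ _)
    ... | true  | true  = ⊥-elim (U₁-independent u∈U₁ (lookup⇒[]= w U₁ w∈U₁) uw)

  ∣N₁⁺x₁∣*∣U₁∣≡∣W₁∣ : ∣ N₁⁺ E U₁ W₁ x₁ ∣ * ∣ U₁ ∣ ≡ ∣ W₁ ∣
  ∣N₁⁺x₁∣*∣U₁∣≡∣W₁∣ = begin
    ∣ N₁⁺ E U₁ W₁ x₁ ∣ * ∣ U₁ ∣    ≡⟨ cong₂ _*_ (∣N₁⁺∣≡deg⁺W₁ x₁∈U₁) (∣p∣≡count U₁) ⟩
    deg⁺W₁ x₁ * count (lookup U₁)  ≡⟨ *-comm (deg⁺W₁ x₁) _ ⟩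
    count (lookup U₁) * deg⁺W₁ x₁  ≡⟨ double-count R (lookup U₁) (lookup W₁) _ R⊆U₁ rows R⊆W₁ columns ⟩
    count (lookup W₁)              ≡⟨ sym (∣p∣≡count W₁) ⟩
    ∣ W₁ ∣                         ∎
    where
    open ≡-Reasoning
    R : Fin n → Fin n → Bool
    R u w = lookup U₁ u ∧ (lookup W₁ w ∧ E u w)
    R⊆U₁ : ∀ u w → R u w ≡ true → lookup U₁ u ≡ true
    R⊆U₁ u w = Bool.∧-conicalˡ _ _
    R⊆W₁ : ∀ u w → R u w ≡ true → lookup W₁ w ≡ true
    R⊆W₁ u w = Bool.∧-conicalˡ (lookup W₁ w) (E u w) ∘ Bool.∧-conicalʳ (lookup U₁ u) _
    rows : ∀ u → lookup U₁ u ≡ true → count (R u) ≡ deg⁺W₁ x₁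
    rows u u∈U₁ rewrite u∈U₁ = deg⁺W₁-orbit (lookup⇒[]= u U₁ u∈U₁)
    columns : ∀ w → lookup W₁ w ≡ true → count (λ u → R u w) ≡ 1
    columns w w∈W₁ with W₁-in-neighbour (lookup⇒[]= w W₁ w∈W₁)
    ... | u₀ , u₀∈U₁ , u₀w rewrite w∈W₁ =
      count-≡1 _ (cong₂ _∧_ ([]=⇒lookup u₀∈U₁) u₀w)
        (λ u Ruw → U₁-common-out⇒≡ (lookup⇒[]= u U₁ (Bool.∧-conicalˡ _ _ Ruw)) u₀∈U₁
                                     (Bool.∧-conicalʳ _ _ Ruw) u₀w)

  ∣U₁∣≡∣W₁∣⇒deg⁺W₁x₁≡1 : ∣ U₁ ∣ ≡ ∣ W₁ ∣ → deg⁺W₁ x₁ ≡ 1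
  ∣U₁∣≡∣W₁∣⇒deg⁺W₁x₁≡1 ∣U₁∣≡∣W₁∣ = *-cancelʳ-≡ _ 1 ∣ U₁ ∣ (begin
    deg⁺W₁ x₁ * ∣ U₁ ∣          ≡⟨ cong (_* ∣ U₁ ∣) (sym (∣N₁⁺∣≡deg⁺W₁ x₁∈U₁)) ⟩
    ∣ N₁⁺ E U₁ W₁ x₁ ∣ * ∣ U₁ ∣  ≡⟨ ∣N₁⁺x₁∣*∣U₁∣≡∣W₁∣ ⟩
    ∣ W₁ ∣                      ≡⟨ sym ∣U₁∣≡∣W₁∣ ⟩
    ∣ U₁ ∣                      ≡⟨ sym (*-identityˡ _) ⟩
    1 * ∣ U₁ ∣                  ∎)
    where
    open ≡-Reasoning
    instance
      ∣U₁∣≢0 = >-nonZero (subst (1 ≤_) (sym (∣p∣≡count U₁)) (count-≥1 (lookup U₁) ([]=⇒lookup x₁∈U₁)))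

  ∣U₁∣≡∣W₁∣⇒unique-out : ∣ U₁ ∣ ≡ ∣ W₁ ∣ → ∀ {u b d} → u ∈ U₁ → b ∈ W₁ → d ∈ W₁
                        → Adj E u b → Adj E u d → b ≡ d
  ∣U₁∣≡∣W₁∣⇒unique-out ∣U₁∣≡∣W₁∣ {u} {b} {d} u∈U₁ b∈W₁ d∈W₁ ub ud with b ≟ d
  ... | yes b≡d = b≡d
  ... | no b≢d  =
    case subst (2 ≤_) deg⁺W₁u≡1 (count-≥2 _ (out b∈W₁ ub) (out d∈W₁ ud) b≢d) of λ { (s≤s ()) }
    where
    out : ∀ {w} → w ∈ W₁ → Adj E u w → lookup W₁ w ∧ E u w ≡ true
    out w∈W₁ uw = cong₂ _∧_ ([]=⇒lookup w∈W₁) uw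
    deg⁺W₁u≡1 : deg⁺W₁ u ≡ 1
    deg⁺W₁u≡1 = trans (deg⁺W₁-orbit u∈U₁) (∣U₁∣≡∣W₁∣⇒deg⁺W₁x₁≡1 ∣U₁∣≡∣W₁∣)

  W₁U₁-Edge : Set
  W₁U₁-Edge = ∃[ w ] ∃[ u ] (w ∈ W₁ × u ∈ U₁ × Adj E w u)

  W₁U₁-edge? : Dec W₁U₁-Edge
  W₁U₁-edge? = any? λ w → any? λ u → (w ∈? W₁) ×-dec (u ∈? U₁) ×-dec (E w u Bool.≟ true)

  module _ (W₁→U₁ : W₁U₁-Edge) where

    W₁-out-neighbour : ∀ {w} → w ∈ W₁ → ∃[ u ] (u ∈ U₁ × Adj E w u)
    W₁-out-neighbour = let (_ , _ , w₀∈W₁ , u₀∈U₁ , w₀u₀) = W₁→U₁ in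
      orbit-out-neighbour W₁-orbit U₁-orbit w₀∈W₁ u₀∈U₁ w₀u₀

    E₁-sym : ∀ {a b} → E₁ E U₁ W₁ a b → E₁ E U₁ W₁ b a
    E₁-sym ab@(a∈V₁ , b∈V₁ , ab′) with E₁-orientation ab
    ... | inj₁ (a∈U₁ , b∈W₁) = b∈V₁ , a∈V₁ ,
      mutual-out-neighbours⇒sym n2 U₁-common-out⇒≡ U₁-out-neighbour W₁-out-neighbour a∈U₁ b∈W₁ ab′
    ... | inj₂ (a∈W₁ , b∈U₁) = b∈V₁ , a∈V₁ ,
      mutual-out-neighbours⇒sym n2 W₁-common-out⇒≡ W₁-out-neighbour U₁-out-neighbour a∈W₁ b∈U₁ ab′

    disjoint-symmetric-edges : DisjointSymEdges₁ E U₁ W₁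
    disjoint-symmetric-edges = (λ _ _ → E₁-sym) , disjoint
      where
      disjoint : ∀ a b c d → E₁ E U₁ W₁ a b → E₁ E U₁ W₁ c d
               → ((a ≡ c × b ≡ d) ⊎ (a ≡ d × b ≡ c)) ⊎ Disj E U₁ W₁ a b c d
      disjoint a b c d ab cd with a ≟ c | a ≟ d | b ≟ c | b ≟ d
      ... | yes refl | _        | _        | _        = inj₁ (inj₁ (refl , E₁-common-head⇒≡ (E₁-sym ab) (E₁-sym cd)))
      ... | no _     | yes refl | _        | _        = inj₁ (inj₂ (refl , E₁-common-head⇒≡ (E₁-sym ab) cd))
      ... | no _     | no _     | yes refl | _        = inj₁ (inj₂ (E₁-common-head⇒≡ ab (E₁-sym cd) , refl))
      ... | no a≢c   | no _     | no _     | yes refl = ⊥-elim (a≢c (E₁-common-head⇒≡ ab cd))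
      ... | no a≢c   | no a≢d   | no b≢c   | no b≢d   = inj₂ (a≢c , a≢d , b≢c , b≢d)

  module _ (∄W₁U₁ : ¬ W₁U₁-Edge) where

    E₁-oriented : ∀ {a b} → E₁ E U₁ W₁ a b → a ∈ U₁ × b ∈ W₁
    E₁-oriented ab@(_ , _ , ab′) with E₁-orientation ab
    ... | inj₁ a∈U₁×b∈W₁     = a∈U₁×b∈W₁
    ... | inj₂ (a∈W₁ , b∈U₁) = ⊥-elim (∄W₁U₁ (_ , _ , a∈W₁ , b∈U₁ , ab′))

    sources : SourcesU₁ E U₁ W₁
    sources u u∈U₁ z zu = U₁∩W₁≡∅ u∈U₁ (proj₂ (E₁-oriented zu))

    sinks : SinksW₁ E U₁ W₁
    sinks w w∈W₁ z wz = U₁∩W₁≡∅ (proj₁ (E₁-oriented wz)) w∈W₁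

    star-forest : StarForest₁ E U₁ W₁
    star-forest x y xy = inj₂ y-leaf
      where
      y-leaf : LeafOf E U₁ W₁ y x
      y-leaf z (inj₁ yz) = ⊥-elim (sinks y (proj₂ (E₁-oriented xy)) z yz)
      y-leaf z (inj₂ zy) = E₁-common-head⇒≡ zy xy

    ∣U₁∣≡∣W₁∣⇒disjoint-edges : ∣ U₁ ∣ ≡ ∣ W₁ ∣ → DisjointEdges₁ E U₁ W₁
    ∣U₁∣≡∣W₁∣⇒disjoint-edges ∣U₁∣≡∣W₁∣ a b c d ab cd with E₁-oriented ab | E₁-oriented cd | a ≟ c
    ... | a∈U₁ , b∈W₁ | _ , d∈W₁ | yes refl =
      inj₁ (refl , ∣U₁∣≡∣W₁∣⇒unique-out ∣U₁∣≡∣W₁∣ a∈U₁ b∈W₁ d∈W₁ (proj₂ (proj₂ ab)) (proj₂ (proj₂ cd)))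
    ... | a∈U₁ , b∈W₁ | c∈U₁ , d∈W₁ | no a≢c = inj₂
      ( a≢c
      , (λ { refl → U₁∩W₁≡∅ a∈U₁ d∈W₁ })
      , (λ { refl → U₁∩W₁≡∅ c∈U₁ b∈W₁ })
      , (λ { refl → a≢c (E₁-common-head⇒≡ ab cd) }))

theorem5p3 : (n : ℕ) (E : Edges n) (col : Fin n → Bool)
    → Is2qBMG E col → Thin E
    → (U₁ W₁ : Subset n)
    → (∀ x → x ∈ U₁ → col x ≡ true) → (∀ x → x ∈ W₁ → col x ≡ false)
    → IsOrbit E U₁ → IsOrbit E W₁
    → (x₁ y₁ : Fin n) → x₁ ∈ U₁ → y₁ ∈ W₁ → Adj E x₁ y₁
    → ((StarForest₁ E U₁ W₁ × SourcesU₁ E U₁ W₁ × SinksW₁ E U₁ W₁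
          × ∣ N₁⁺ E U₁ W₁ x₁ ∣ * ∣ U₁ ∣ ≡ ∣ W₁ ∣
          × (∣ U₁ ∣ ≡ ∣ W₁ ∣ → DisjointEdges₁ E U₁ W₁))
       ⊎ DisjointSymEdges₁ E U₁ W₁)
theorem5p3 n E col (_ , proper , n1 , n2 , n3) thin U₁ W₁ U₁⊆U W₁⊆W U₁-orbit W₁-orbit x₁ y₁ x₁∈U₁ y₁∈W₁ x₁y₁ =
  case W₁U₁-edge? of λ where
    (yes W₁→U₁) → inj₂ (disjoint-symmetric-edges W₁→U₁)
    (no ∄W₁→U₁) → inj₁ ( star-forest ∄W₁→U₁ , sources ∄W₁→U₁ , sinks ∄W₁→U₁
                       , ∣N₁⁺x₁∣*∣U₁∣≡∣W₁∣ , ∣U₁∣≡∣W₁∣⇒disjoint-edges ∄W₁→U₁)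
  where open OrbitPair proper n1 n2 n3 thin U₁⊆U W₁⊆W U₁-orbit W₁-orbit x₁∈U₁ y₁∈W₁ x₁y₁
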